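{- For $n\ge 0$, let $a(n)$ denote the sum, over all strict Motzkin paths of length $n$, of the area under the path. Then the generating function $X(t)=\sum_{n\ge 0} a(n)t^n$ satisfies $$\left(3t^{2}+2t-1\right)X+t^{2}=0,$$ that is, $$X(t)=\frac{t^{2}}{1-2t-3t^{2}}.$$
   Context: A Motzkin path of length $n$ is a lattice walk $(0,y_0),(1,y_1),\dots,(n,y_n)$ with $y_0=y_n=0$, each step $(k-1,y_{k-1})\to(k,y_k)$ satisfying $y_k-y_{k-1}\in\{1,0,-1\}$, and $y_k\ge 0$ for all $k$. It is strict if, in addition, $y_k>0$ for all $0<k<n$, i.e. the path touches the $x$-axis only at its endpoints. The empty path ($n=0$) is not counted as strict. The area under a path is $\sum_{k=1}^{n-1} y_k$, the sum of the $y$-coordinates of its intermediate points; this equals the geometric area between the piecewise-linear path and the $x$-axis. -}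

module Defs where

open import Data.Nat as ℕ using (ℕ; zero; suc; _∸_)
open import Data.Integer as ℤ using (ℤ; +_; -[1+_])
open import Data.Fin using (Fin; toℕ)
open import Data.Fin.Properties using (all?)
open import Data.Vec using (Vec; []; _∷_; toList)
open import Data.List as List using (List; []; _∷_; map; upTo; take; concatMap)
open import Data.Product using (_×_)
open import Relation.Binary.PropositionalEquality using (_≡_)
open import Relation.Nullary using (Dec; yes; no)
open import Relation.Nullary.Decidable using (_×-dec_; _→-dec_)

data Step : Set where
  up flat down : Step

δ : Step → ℤ
δ up   = + 1
δ flat = + 0
δ down = -[1+ 0 ]

sumℤ : List ℤ → ℤ
sumℤ = List.foldr ℤ._+_ (+ 0)

-- A walk of length n is determined by its step sequence (y_0 = 0).
-- height w k = y_k = sum of the first k steps.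
height : {n : ℕ} → Vec Step n → ℕ → ℤ
height w k = sumℤ (map δ (take k (toList w)))

StrictMotzkin : {n : ℕ} → Vec Step n → Set
StrictMotzkin {n} w =
  (0 ℕ.< n)
  × (height w n ≡ + 0)
  × ((k : Fin (suc n)) → + 0 ℤ.≤ height w (toℕ k))
  × ((k : Fin (suc n)) → 0 ℕ.< toℕ k → toℕ k ℕ.< n → + 0 ℤ.< height w (toℕ k))

strictMotzkin? : {n : ℕ} (w : Vec Step n) → Dec (StrictMotzkin w)
strictMotzkin? {n} w =
  (0 ℕ.<? n)
  ×-dec (height w n ℤ.≟ + 0)
  ×-dec all? (λ k → + 0 ℤ.≤? height w (toℕ k))
  ×-dec all? (λ k → (0 ℕ.<? toℕ k) →-dec ((toℕ k ℕ.<? n) →-dec (+ 0 ℤ.<? height w (toℕ k))))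

area : {n : ℕ} → Vec Step n → ℤ
area {n} w = sumℤ (map (λ k → height w (suc k)) (upTo (n ∸ 1)))

allWalks : (n : ℕ) → List (Vec Step n)
allWalks zero    = [] ∷ []
allWalks (suc n) = concatMap (λ w → (up ∷ w) ∷ (flat ∷ w) ∷ (down ∷ w) ∷ []) (allWalks n)

a : ℕ → ℤ
a n = sumℤ (map (λ w → contrib w (strictMotzkin? w)) (allWalks n))
  where
  contrib : Vec Step n → {P : Set} → Dec P → ℤ
  contrib w (yes _) = area w
  contrib w (no _)  = + 0

FPS : Set
FPS = ℕ → ℤ

_·_ : FPS → FPS → FPS
(f · g) n = sumℤ (map (λ i → f i ℤ.* g (n ∸ i)) (upTo (suc n)))

_⊕_ : FPS → FPS → FPS
(f ⊕ g) n = f n ℤ.+ g n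

P : FPS
P 0 = -[1+ 0 ]
P 1 = + 2
P 2 = + 3
P (suc (suc (suc _))) = + 0

t² : FPS
t² 2 = + 1
t² _ = + 0

𝟘 : FPS
𝟘 _ = + 0

X : FPS
X = a

-- Let z be the series of first passages from height 1 to 0: walks that stay positive and end at 0.
-- A strict Motzkin path is an up step followed by such a passage, and its area is the height sum
-- of the passage.  Conditioning on the first step, the series C g of passages from height g + 1
-- and A g of their height sums satisfy the linear systems
--   C g = t (C (g + 1) + C g + C (g - 1)),              C (-1) = 1,
--   A g = (g + 1) C g + t (A (g + 1) + A g + A (g - 1)),  A (-1) = 0,
-- and such a system has at most one solution in formal power series.  Comparing with explicit
-- solutions gives C g = z ^ (g + 1) with z = t (1 + z + z²), and (1 - z²)² A 0 = z (1 + z + z²).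
-- Since X = t A 0, multiplying the claim by (1 - z²)² turns it into
--   (3t² + 2t - 1) z² + t² (1 - z²)² = (t (1 + z + z²) - z) (t + z - t z + t z²) = 0,
-- and (1 - z²)² may be cancelled because its constant term is 1.

module Submission where

open import Defs hiding (_⊕_)
open Defs using () renaming (_⊕_ to infixl 6 _⊕_; 𝟘 to 0#)

open import Algebra.Bundles using (CommutativeRing)
import Algebra.Solver.Ring.AlmostCommutativeRing as ACR
open import Data.Bool using (if_then_else_)
open import Data.Empty using (⊥-elim)
open import Data.Fin as Fin using (Fin)
import Data.Fin.Properties as FinP
open import Data.Integer as ℤ using (ℤ; +_; -[1+_])
import Data.Integer.Properties as ℤP
open import Data.Integer.Tactic.RingSolver using (solve-∀)
open import Data.List using (List; []; _∷_; map; applyUpTo; concatMap)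
open import Data.Maybe using (Maybe; just; nothing)
open import Data.Nat as ℕ using (ℕ; zero; suc; _∸_)
open import Data.Nat.Induction using (<-rec)
import Data.Nat.Properties as ℕP
open import Data.Product using (Σ-syntax; _×_; _,_; proj₁)
open import Data.Sum using (inj₁; inj₂)
open import Data.Vec using (Vec; []; _∷_)
open import Function.Bundles using (_⇔_; mk⇔)
open import Relation.Binary.PropositionalEquality
  using (_≡_; refl; sym; trans; cong; cong₂; subst; module ≡-Reasoning)
import Relation.Binary.Reasoning.Setoid
open import Relation.Nullary using (Dec; yes; no; does)
import Relation.Nullary.Decidable as Dec

open import Algebra.Properties.CommutativeSemigroup ℤP.+-commutativeSemigroup using (interchange)

-- Formal power series

infix 4 _≈_
_≈_ : FPS → FPS → Set
f ≈ g = ∀ n → f n ≡ g n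

tail : FPS → FPS
tail f n = f (suc n)

infixl 7 _*_
_*_ : FPS → FPS → FPS
(f * g) zero    = f 0 ℤ.* g 0
(f * g) (suc n) = f 0 ℤ.* g (suc n) ℤ.+ (tail f * g) n

infix 8 -_
-_ : FPS → FPS
(- f) n = ℤ.- f n

constant : ℤ → FPS
constant c zero    = c
constant c (suc _) = + 0

1# : FPS
1# = constant (+ 1)

infixr 7 _•_
_•_ : ℤ → FPS → FPS
(c • f) n = c ℤ.* f n

⊕-congˡ : ∀ {f f′} g → f ≈ f′ → f ⊕ g ≈ f′ ⊕ g
⊕-congˡ g f≈f′ n = cong (ℤ._+ g n) (f≈f′ n)

⊕-congʳ : ∀ f {g g′} → g ≈ g′ → f ⊕ g ≈ f ⊕ g′
⊕-congʳ f g≈g′ n = cong (ℤ._+_ (f n)) (g≈g′ n)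

*-congˡ : ∀ {f f′} g → f ≈ f′ → f * g ≈ f′ * g
*-congˡ g f≈f′ zero    = cong (ℤ._* g 0) (f≈f′ 0)
*-congˡ g f≈f′ (suc n) =
  cong₂ ℤ._+_ (cong (ℤ._* g (suc n)) (f≈f′ 0)) (*-congˡ g (λ k → f≈f′ (suc k)) n)

*-congʳ : ∀ f {g g′} → g ≈ g′ → f * g ≈ f * g′
*-congʳ f g≈g′ zero    = cong (f 0 ℤ.*_) (g≈g′ 0)
*-congʳ f g≈g′ (suc n) = cong₂ ℤ._+_ (cong (f 0 ℤ.*_) (g≈g′ (suc n))) (*-congʳ (tail f) g≈g′ n)

*-distribʳ-+ : ∀ h f g → (f ⊕ g) * h ≈ f * h ⊕ g * h
*-distribʳ-+ h f g zero    = ℤP.*-distribʳ-+ (h 0) (f 0) (g 0)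
*-distribʳ-+ h f g (suc n) = trans
  (cong₂ ℤ._+_ (ℤP.*-distribʳ-+ (h (suc n)) (f 0) (g 0)) (*-distribʳ-+ h (tail f) (tail g) n))
  (interchange (f 0 ℤ.* h (suc n)) (g 0 ℤ.* h (suc n)) ((tail f * h) n) ((tail g * h) n))

*-distribˡ-+ : ∀ f g h → f * (g ⊕ h) ≈ f * g ⊕ f * h
*-distribˡ-+ f g h zero    = ℤP.*-distribˡ-+ (f 0) (g 0) (h 0)
*-distribˡ-+ f g h (suc n) = trans
  (cong₂ ℤ._+_ (ℤP.*-distribˡ-+ (f 0) (g (suc n)) (h (suc n))) (*-distribˡ-+ (tail f) g h n))
  (interchange (f 0 ℤ.* g (suc n)) (f 0 ℤ.* h (suc n)) ((tail f * g) n) ((tail f * h) n))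

•-*-assoc : ∀ c f g → (c • f) * g ≈ c • (f * g)
•-*-assoc c f g zero    = ℤP.*-assoc c (f 0) (g 0)
•-*-assoc c f g (suc n) = trans
  (cong₂ ℤ._+_ (ℤP.*-assoc c (f 0) (g (suc n))) (•-*-assoc c (tail f) g n))
  (sym (ℤP.*-distribˡ-+ c (f 0 ℤ.* g (suc n)) ((tail f * g) n)))

*-zeroˡ : ∀ f → 0# * f ≈ 0#
*-zeroˡ f zero    = refl
*-zeroˡ f (suc n) = trans (ℤP.+-identityˡ _) (*-zeroˡ f n)

*-identityˡ : ∀ f → 1# * f ≈ f
*-identityˡ f zero    = ℤP.*-identityˡ (f 0)
*-identityˡ f (suc n) =
  trans (cong₂ ℤ._+_ (ℤP.*-identityˡ (f (suc n))) (*-zeroˡ f n)) (ℤP.+-identityʳ _)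

*-suc-last : ∀ f g n → (f * g) (suc n) ≡ (f * tail g) n ℤ.+ f (suc n) ℤ.* g 0
*-suc-last f g zero    = refl
*-suc-last f g (suc n) = trans
  (cong (ℤ._+_ (f 0 ℤ.* g (suc (suc n)))) (*-suc-last (tail f) g n))
  (sym (ℤP.+-assoc (f 0 ℤ.* g (suc (suc n))) ((tail f * tail g) n) (f (suc (suc n)) ℤ.* g 0)))

*-comm : ∀ f g → f * g ≈ g * f
*-comm f g zero    = ℤP.*-comm (f 0) (g 0)
*-comm f g (suc n) = trans (*-suc-last f g n)
  (trans (cong₂ ℤ._+_ (*-comm f (tail g) n) (ℤP.*-comm (f (suc n)) (g 0)))
         (ℤP.+-comm ((tail g * f) n) (g 0 ℤ.* f (suc n))))

*-assoc : ∀ f g h → (f * g) * h ≈ f * (g * h)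
*-assoc f g h zero    = ℤP.*-assoc (f 0) (g 0) (h 0)
*-assoc f g h (suc n) = trans
  (cong (ℤ._+_ ((f 0 ℤ.* g 0) ℤ.* h (suc n)))
    (trans (*-distribʳ-+ h (f 0 • tail g) (tail f * g) n)
           (cong₂ ℤ._+_ (•-*-assoc (f 0) (tail g) h n) (*-assoc (tail f) g h n))))
  (regroup (f 0) (g 0) (h (suc n)) ((tail g * h) n) ((tail f * (g * h)) n))
  where
  regroup : ∀ a b c d e → (a ℤ.* b) ℤ.* c ℤ.+ (a ℤ.* d ℤ.+ e) ≡ a ℤ.* (b ℤ.* c ℤ.+ d) ℤ.+ e
  regroup = solve-∀

+-*-commutativeRing : CommutativeRing _ _
+-*-commutativeRing = record
  { Carrier = FPS
  ; _≈_ = _≈_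
  ; _+_ = _⊕_
  ; _*_ = _*_
  ; -_ = -_
  ; 0# = 0#
  ; 1# = 1#
  ; isCommutativeRing = record
    { isRing = record
      { +-isAbelianGroup = record
        { isGroup = record
          { isMonoid = record
            { isSemigroup = record
              { isMagma = record
                { isEquivalence = record
                  { refl = λ _ → refl
                  ; sym = λ f≈g n → sym (f≈g n)
                  ; trans = λ f≈g g≈h n → trans (f≈g n) (g≈h n)
                  }
                ; ∙-cong = λ f≈f′ g≈g′ n → cong₂ ℤ._+_ (f≈f′ n) (g≈g′ n)
                }
              ; assoc = λ f g h n → ℤP.+-assoc (f n) (g n) (h n)
              }
            ; identity = (λ f n → ℤP.+-identityˡ (f n)) , (λ f n → ℤP.+-identityʳ (f n))
            }
          ; inverse = (λ f n → ℤP.+-inverseˡ (f n)) , (λ f n → ℤP.+-inverseʳ (f n))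
          ; ⁻¹-cong = λ f≈g n → cong ℤ.-_ (f≈g n)
          }
        ; comm = λ f g n → ℤP.+-comm (f n) (g n)
        }
      ; *-cong = λ {f} {f′} {g} f≈f′ g≈g′ n → trans (*-congˡ g f≈f′ n) (*-congʳ f′ g≈g′ n)
      ; *-assoc = *-assoc
      ; *-identity = *-identityˡ , (λ f n → trans (*-comm f 1# n) (*-identityˡ f n))
      ; distrib = *-distribˡ-+ , (λ h f g → *-distribʳ-+ h f g)
      }
    ; *-comm = *-comm
    }
  }

constant-* : ∀ c f → constant c * f ≈ c • f
constant-* c f zero    = refl
constant-* c f (suc n) = trans (cong (ℤ._+_ (c ℤ.* f (suc n))) (*-zeroˡ f n)) (ℤP.+-identityʳ _)

constant-morphism : CommutativeRing.rawRing ℤP.+-*-commutativeRing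
                      ACR.-Raw-AlmostCommutative⟶ ACR.fromCommutativeRing +-*-commutativeRing
constant-morphism = record
  { ⟦_⟧    = constant
  ; +-homo = λ { a b zero → refl ; a b (suc n) → refl }
  ; *-homo = λ a b n → sym (trans (constant-* a (constant b) n) (•-constant a b n))
  ; -‿homo = λ { a zero → refl ; a (suc n) → refl }
  ; 0-homo = λ { zero → refl ; (suc n) → refl }
  ; 1-homo = λ { zero → refl ; (suc n) → refl }
  }
  where
  •-constant : ∀ a b → a • constant b ≈ constant (a ℤ.* b)
  •-constant a b zero    = refl
  •-constant a b (suc n) = ℤP.*-zeroʳ a

constant-≟ : ∀ a b → Maybe (constant a ≈ constant b)
constant-≟ a b with a ℤ.≟ b
... | yes refl = just (λ _ → refl)
... | no _     = nothing

open import Algebra.Solver.Ring (CommutativeRing.rawRing ℤP.+-*-commutativeRing)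
  (ACR.fromCommutativeRing +-*-commutativeRing) constant-morphism constant-≟
  using (Polynomial; solve; _:=_; con; _:+_; _:*_; :-_)

open CommutativeRing +-*-commutativeRing
  using (setoid; +-identityˡ; zeroʳ; *-identityʳ)
  renaming (sym to ≈-sym; trans to ≈-trans)
module ≈-Reasoning = Relation.Binary.Reasoning.Setoid setoid

t : FPS
t 1 = + 1
t _ = + 0

t*-suc : ∀ f n → (t * f) (suc n) ≡ f n
t*-suc f n = trans (ℤP.+-identityˡ _) (trans (*-congˡ f tail-t n) (*-identityˡ f n))
  where
  tail-t : tail t ≈ 1#
  tail-t zero    = refl
  tail-t (suc n) = refl

⊕t*-zero : ∀ s x → (s ⊕ t * x) 0 ≡ s 0
⊕t*-zero s x = ℤP.+-identityʳ (s 0)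

⊕t*-suc : ∀ s x n → (s ⊕ t * x) (suc n) ≡ s (suc n) ℤ.+ x n
⊕t*-suc s x n = cong (ℤ._+_ (s (suc n))) (t*-suc x n)

≈⊕t*-intro : ∀ {f} s x → f 0 ≡ s 0 → (∀ n → f (suc n) ≡ s (suc n) ℤ.+ x n) → f ≈ s ⊕ t * x
≈⊕t*-intro s x f₀ fₛ zero    = trans f₀ (sym (⊕t*-zero s x))
≈⊕t*-intro s x f₀ fₛ (suc n) = trans (fₛ n) (sym (⊕t*-suc s x n))

*-vanishes : ∀ f {g} n → (∀ {j} → j ℕ.≤ n → g j ≡ + 0) → (f * g) n ≡ + 0
*-vanishes f zero    g≡0 = trans (cong (f 0 ℤ.*_) (g≡0 ℕ.z≤n)) (ℤP.*-zeroʳ (f 0))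
*-vanishes f (suc n) g≡0 = cong₂ ℤ._+_
  (trans (cong (f 0 ℤ.*_) (g≡0 ℕP.≤-refl)) (ℤP.*-zeroʳ (f 0)))
  (*-vanishes (tail f) n (λ j≤n → g≡0 (ℕP.m≤n⇒m≤1+n j≤n)))

*≈0⇒≈0 : ∀ {f g} → f 0 ≡ + 1 → f * g ≈ 0# → g ≈ 0#
*≈0⇒≈0 {f} {g} f₀≡1 fg≈0 = <-rec (λ n → g n ≡ + 0) vanishes
  where
  leading : ∀ n → f 0 ℤ.* g n ≡ g n
  leading n = trans (cong (ℤ._* g n) f₀≡1) (ℤP.*-identityˡ (g n))
  vanishes : ∀ n → (∀ {j} → j ℕ.< n → g j ≡ + 0) → g n ≡ + 0
  vanishes zero    _   = trans (sym (leading 0)) (fg≈0 0)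
  vanishes (suc n) ih = begin
    g (suc n)                                       ≡⟨ sym (leading (suc n)) ⟩
    f 0 ℤ.* g (suc n)                               ≡⟨ sym (ℤP.+-identityʳ _) ⟩
    f 0 ℤ.* g (suc n) ℤ.+ + 0                       ≡⟨ cong (ℤ._+_ (f 0 ℤ.* g (suc n)))
                                                         (sym (*-vanishes (tail f) n (λ j≤n → ih (ℕ.s≤s j≤n)))) ⟩
    (f * g) (suc n)                                 ≡⟨ fg≈0 (suc n) ⟩
    + 0                                             ∎
    where open ≡-Reasoning

map-applyUpTo : ∀ {A B : Set} (f : A → B) (g : ℕ → A) n → map f (applyUpTo g n) ≡ applyUpTo (λ i → f (g i)) n
map-applyUpTo f g zero    = refl
map-applyUpTo f g (suc n) = cong (f (g 0) ∷_) (map-applyUpTo f (λ i → g (suc i)) n)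

applyUpTo-cong : ∀ {A : Set} {f g : ℕ → A} → (∀ k → f k ≡ g k) → ∀ n → applyUpTo f n ≡ applyUpTo g n
applyUpTo-cong f≡g zero    = refl
applyUpTo-cong f≡g (suc n) = cong₂ _∷_ (f≡g 0) (applyUpTo-cong (λ k → f≡g (suc k)) n)

sum-map-cong : ∀ {A : Set} {f g : A → ℤ} → (∀ x → f x ≡ g x) → ∀ xs → sumℤ (map f xs) ≡ sumℤ (map g xs)
sum-map-cong f≡g []       = refl
sum-map-cong f≡g (x ∷ xs) = cong₂ ℤ._+_ (f≡g x) (sum-map-cong f≡g xs)

sum-map-zero : ∀ {A : Set} {f : A → ℤ} → (∀ x → f x ≡ + 0) → ∀ xs → sumℤ (map f xs) ≡ + 0
sum-map-zero f≡0 []       = refl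
sum-map-zero f≡0 (x ∷ xs) = cong₂ ℤ._+_ (f≡0 x) (sum-map-zero f≡0 xs)

sum-map-+ : ∀ {A : Set} (f g : A → ℤ) xs →
            sumℤ (map (λ x → f x ℤ.+ g x) xs) ≡ sumℤ (map f xs) ℤ.+ sumℤ (map g xs)
sum-map-+ f g []       = refl
sum-map-+ f g (x ∷ xs) = trans (cong (ℤ._+_ (f x ℤ.+ g x)) (sum-map-+ f g xs))
  (interchange (f x) (g x) (sumℤ (map f xs)) (sumℤ (map g xs)))

sum-map-*ˡ : ∀ {A : Set} c (f : A → ℤ) xs → sumℤ (map (λ x → c ℤ.* f x) xs) ≡ c ℤ.* sumℤ (map f xs)
sum-map-*ˡ c f []       = sym (ℤP.*-zeroʳ c)
sum-map-*ˡ c f (x ∷ xs) =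
  trans (cong (ℤ._+_ (c ℤ.* f x)) (sum-map-*ˡ c f xs)) (sym (ℤP.*-distribˡ-+ c (f x) _))

·≈* : ∀ f g → f · g ≈ f * g
·≈* f g n = trans (cong sumℤ (map-applyUpTo (λ i → f i ℤ.* g (n ∸ i)) (λ i → i) (suc n))) (convolution f n)
  where
  convolution : ∀ f n → sumℤ (applyUpTo (λ i → f i ℤ.* g (n ∸ i)) (suc n)) ≡ (f * g) n
  convolution f zero    = ℤP.+-identityʳ (f 0 ℤ.* g 0)
  convolution f (suc n) = cong (ℤ._+_ (f 0 ℤ.* g (suc n))) (convolution (tail f) n)

-- Linear systems indexed by height

below : FPS → (ℕ → FPS) → ℕ → FPS
below b F zero    = b
below b F (suc g) = F g

neighbours : FPS → (ℕ → FPS) → ℕ → FPS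
neighbours b F g = F (suc g) ⊕ (F g ⊕ below b F g)

record Solves (S : ℕ → FPS) (b : FPS) (F : ℕ → FPS) : Set where
  constructor solves
  field recursion : ∀ g → F g ≈ S g ⊕ t * neighbours b F g
open Solves

Solves-unique : ∀ {S S′ b b′ F F′} → (∀ g → S g ≈ S′ g) → b ≈ b′ →
                Solves S b F → Solves S′ b′ F′ → ∀ g → F g ≈ F′ g
Solves-unique {S} {S′} {b} {b′} {F} {F′} S≈S′ b≈b′ (solves F-rec) (solves F′-rec) g n = coefficient n g
  where
  open ≡-Reasoning
  coefficient : ∀ n g → F g n ≡ F′ g n
  coefficient zero g = begin
    F g 0   ≡⟨ F-rec g 0 ⟩
    _       ≡⟨ ⊕t*-zero (S g) (neighbours b F g) ⟩
    S g 0   ≡⟨ S≈S′ g 0 ⟩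
    S′ g 0  ≡⟨ sym (⊕t*-zero (S′ g) (neighbours b′ F′ g)) ⟩
    _       ≡⟨ sym (F′-rec g 0) ⟩
    F′ g 0  ∎
  coefficient (suc n) g = begin
    F g (suc n)                                   ≡⟨ F-rec g (suc n) ⟩
    _                                             ≡⟨ ⊕t*-suc (S g) (neighbours b F g) n ⟩
    S g (suc n) ℤ.+ neighbours b F g n            ≡⟨ cong₂ ℤ._+_ (S≈S′ g (suc n)) neighbours≡ ⟩
    S′ g (suc n) ℤ.+ neighbours b′ F′ g n         ≡⟨ sym (⊕t*-suc (S′ g) (neighbours b′ F′ g) n) ⟩
    _                                             ≡⟨ sym (F′-rec g (suc n)) ⟩
    F′ g (suc n)                                  ∎
    where
    below≡ : ∀ g → below b F g n ≡ below b′ F′ g n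
    below≡ zero    = b≈b′ n
    below≡ (suc g) = coefficient n g
    neighbours≡ : neighbours b F g n ≡ neighbours b′ F′ g n
    neighbours≡ = cong₂ ℤ._+_ (coefficient n (suc g)) (cong₂ ℤ._+_ (coefficient n g) (below≡ g))

Solves-suc : ∀ {S b F} → Solves S b F → Solves (λ g → S (suc g)) (F 0) (λ g → F (suc g))
Solves-suc (solves F-rec) = solves λ { zero → F-rec 1 ; (suc g) → F-rec (suc (suc g)) }

Solves-scale : ∀ {S b F} c → Solves S b F → Solves (λ g → c * S g) (c * b) (λ g → c * F g)
Solves-scale {S} {b} {F} c (solves F-rec) = solves λ { zero → scaled 0 ; (suc g) → scaled (suc g) }
  where
  distribute : ∀ g → c * (S g ⊕ t * neighbours b F g) ≈
               c * S g ⊕ t * (c * F (suc g) ⊕ (c * F g ⊕ c * below b F g))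
  distribute g = solve 6
    (λ c s t x y w → c :* (s :+ t :* (x :+ (y :+ w))) := c :* s :+ t :* (c :* x :+ (c :* y :+ c :* w)))
    (λ _ → refl) c (S g) t (F (suc g)) (F g) (below b F g)
  scaled : ∀ g → c * F g ≈ c * S g ⊕ t * (c * F (suc g) ⊕ (c * F g ⊕ c * below b F g))
  scaled g = ≈-trans (*-congʳ c (F-rec g)) (distribute g)

-- First passages

FirstPassage : ∀ {m} → ℤ → Vec Step m → Set
FirstPassage {m} c w = (∀ k → k ℕ.< m → + 0 ℤ.< c ℤ.+ height w k) × (c ℤ.+ height w m ≡ + 0)

FirstPassage-∷ : ∀ {m g c} s (w : Vec Step m) → + suc g ℤ.+ δ s ≡ c →
                 FirstPassage c w ⇔ FirstPassage (+ suc g) (s ∷ w)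
FirstPassage-∷ {m} {g} {c} s w step = mk⇔ extend restrict
  where
  shift : ∀ k → + suc g ℤ.+ height (s ∷ w) (suc k) ≡ c ℤ.+ height w k
  shift k = trans (sym (ℤP.+-assoc (+ suc g) (δ s) (height w k))) (cong (ℤ._+ height w k) step)
  extend : FirstPassage c w → FirstPassage (+ suc g) (s ∷ w)
  extend (positive , end) = positive′ , trans (shift m) end
    where
    positive′ : ∀ k → k ℕ.< suc m → + 0 ℤ.< + suc g ℤ.+ height (s ∷ w) k
    positive′ zero    _     = ℤ.+<+ ℕ.z<s
    positive′ (suc k) k<1+m = subst (+ 0 ℤ.<_) (sym (shift k)) (positive k (ℕ.s<s⁻¹ k<1+m))
  restrict : FirstPassage (+ suc g) (s ∷ w) → FirstPassage c w
  restrict (positive , end) =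
    (λ k k<m → subst (+ 0 ℤ.<_) (shift k) (positive (suc k) (ℕ.s<s k<m))) , trans (sym (shift m)) end

firstPassage-from-0? : ∀ {m} (w : Vec Step m) → Dec (FirstPassage (+ 0) w)
firstPassage-from-0? []      = yes ((λ _ ()) , refl)
firstPassage-from-0? (s ∷ w) = no λ (positive , _) → ℤP.<-irrefl refl (positive 0 ℕ.z<s)

firstPassage? : ∀ {m} g (w : Vec Step m) → Dec (FirstPassage (+ suc g) w)
firstPassage? g       []         = no λ ()
firstPassage? g       (up ∷ w)   = Dec.map (FirstPassage-∷ up w (cong +_ (ℕP.+-comm (suc g) 1)))
                                       (firstPassage? (suc g) w)
firstPassage? g       (flat ∷ w) = Dec.map (FirstPassage-∷ flat w (ℤP.+-identityʳ (+ suc g))) (firstPassage? g w)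
firstPassage? zero    (down ∷ w) = Dec.map (FirstPassage-∷ down w refl) (firstPassage-from-0? w)
firstPassage? (suc g) (down ∷ w) = Dec.map (FirstPassage-∷ down w refl) (firstPassage? g w)

passage : ∀ {m} → ℕ → Vec Step m → ℤ
passage g w = if does (firstPassage? g w) then + 1 else + 0

heightSum : ∀ {m} → ℤ → Vec Step m → ℤ
heightSum c []      = + 0
heightSum c (s ∷ w) = c ℤ.+ heightSum (c ℤ.+ δ s) w

passageArea : ∀ {m} → ℕ → Vec Step m → ℤ
passageArea g w = passage g w ℤ.* heightSum (+ suc g) w

areaAfterStep : ∀ {m} → ℕ → Vec Step (suc m) → ℤ
areaAfterStep g       (up ∷ w)   = passageArea (suc g) w
areaAfterStep g       (flat ∷ w) = passageArea g w
areaAfterStep zero    (down ∷ w) = + 0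
areaAfterStep (suc g) (down ∷ w) = passageArea g w

*-distribˡ-+-swap : ∀ p a h → p ℤ.* (a ℤ.+ h) ≡ a ℤ.* p ℤ.+ p ℤ.* h
*-distribˡ-+-swap = solve-∀

passageArea-∷ : ∀ {m} g (v : Vec Step (suc m)) →
                passageArea g v ≡ + suc g ℤ.* passage g v ℤ.+ areaAfterStep g v
passageArea-∷ g (up ∷ w) = trans
  (cong (λ c → passage (suc g) w ℤ.* (+ suc g ℤ.+ heightSum c w)) (cong +_ (ℕP.+-comm (suc g) 1)))
  (*-distribˡ-+-swap (passage (suc g) w) (+ suc g) (heightSum (+ suc (suc g)) w))
passageArea-∷ g (flat ∷ w) = trans
  (cong (λ c → passage g w ℤ.* (+ suc g ℤ.+ heightSum c w)) (ℤP.+-identityʳ (+ suc g)))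
  (*-distribˡ-+-swap (passage g w) (+ suc g) (heightSum (+ suc g) w))
passageArea-∷ zero    (down ∷ [])    = refl
passageArea-∷ zero    (down ∷ _ ∷ _) = refl
passageArea-∷ (suc g) (down ∷ w)     = *-distribˡ-+-swap (passage g w) (+ suc (suc g)) (heightSum (+ suc g) w)

heightSum-applyUpTo : ∀ {m} c (w : Vec Step m) → sumℤ (applyUpTo (λ k → c ℤ.+ height w k) m) ≡ heightSum c w
heightSum-applyUpTo c []              = refl
heightSum-applyUpTo {suc m} c (s ∷ w) = cong₂ ℤ._+_ (ℤP.+-identityʳ c) (trans
  (cong sumℤ (applyUpTo-cong (λ k → sym (ℤP.+-assoc c (δ s) (height w k))) m))
  (heightSum-applyUpTo (c ℤ.+ δ s) w))

area-up : ∀ {m} (w : Vec Step m) → area (up ∷ w) ≡ heightSum (+ 1) w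
area-up {m} w = trans (cong sumℤ (map-applyUpTo (λ k → height (up ∷ w) (suc k)) (λ k → k) m))
                      (heightSum-applyUpTo (+ 1) w)

strictMotzkin⇒firstPassage : ∀ {m} (w : Vec Step m) → StrictMotzkin (up ∷ w) → FirstPassage (+ 1) w
strictMotzkin⇒firstPassage {m} w (_ , end , _ , positive) = positive′ , end
  where
  positive′ : ∀ k → k ℕ.< m → + 0 ℤ.< + 1 ℤ.+ height w k
  positive′ k k<m = subst (λ j → + 0 ℤ.< + 1 ℤ.+ height w j) (FinP.toℕ-fromℕ< k<1+m)
    (positive (Fin.suc (Fin.fromℕ< k<1+m)) ℕ.z<s
              (ℕ.s<s (subst (ℕ._< m) (sym (FinP.toℕ-fromℕ< k<1+m)) k<m)))
    where
    k<1+m : k ℕ.< suc m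
    k<1+m = ℕP.m<n⇒m<1+n k<m

firstPassage⇒strictMotzkin : ∀ {m} (w : Vec Step m) → FirstPassage (+ 1) w → StrictMotzkin (up ∷ w)
firstPassage⇒strictMotzkin {m} w (positive , end) = ℕ.z<s , end , nonnegative , positive′
  where
  nonnegative : (k : Fin (suc (suc m))) → + 0 ℤ.≤ height (up ∷ w) (Fin.toℕ k)
  nonnegative Fin.zero    = ℤP.≤-refl
  nonnegative (Fin.suc k) with ℕP.m<1+n⇒m<n∨m≡n (FinP.toℕ<n k)
  ... | inj₁ k<m = ℤP.<⇒≤ (positive (Fin.toℕ k) k<m)
  ... | inj₂ k≡m = ℤP.≤-reflexive (sym (subst (λ j → + 1 ℤ.+ height w j ≡ + 0) (sym k≡m) end))
  positive′ : (k : Fin (suc (suc m))) → 0 ℕ.< Fin.toℕ k → Fin.toℕ k ℕ.< suc m →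
              + 0 ℤ.< height (up ∷ w) (Fin.toℕ k)
  positive′ Fin.zero    ()
  positive′ (Fin.suc k) _ k<1+m = positive (Fin.toℕ k) (ℕ.s<s⁻¹ k<1+m)

strictArea : ∀ {n} → Vec Step n → ℤ
strictArea w with strictMotzkin? w
... | yes _ = area w
... | no _  = + 0

-- The summand of `a` is local to its definition; unification names it.
a-summand : ∀ n → Σ[ f ∈ (Vec Step n → ℤ) ] a n ≡ sumℤ (map f (allWalks n))
a-summand n = _ , refl

a-summand≡strictArea : ∀ n (w : Vec Step n) → proj₁ (a-summand n) w ≡ strictArea w
a-summand≡strictArea n w with strictMotzkin? w
... | yes _ = refl
... | no _  = refl

strictArea-up : ∀ {m} (w : Vec Step m) → strictArea (up ∷ w) ≡ passageArea 0 w
strictArea-up w with strictMotzkin? (up ∷ w) | firstPassage? 0 w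
... | yes _ | yes _  = trans (area-up w) (sym (ℤP.*-identityˡ _))
... | yes p | no ¬q  = ⊥-elim (¬q (strictMotzkin⇒firstPassage w p))
... | no ¬p | yes q  = ⊥-elim (¬p (firstPassage⇒strictMotzkin w q))
... | no _  | no _   = refl

strictArea-flat : ∀ {m} (w : Vec Step m) → strictArea (flat ∷ w) ≡ + 0
strictArea-flat w with strictMotzkin? (flat ∷ w)
strictArea-flat []      | yes _                  = refl
strictArea-flat (_ ∷ _) | yes (_ , _ , _ , positive) with positive (Fin.suc Fin.zero) ℕ.z<s (ℕ.s<s ℕ.z<s)
... | ℤ.+<+ ()
strictArea-flat w       | no _                   = refl

strictArea-down : ∀ {m} (w : Vec Step m) → strictArea (down ∷ w) ≡ + 0
strictArea-down w with strictMotzkin? (down ∷ w)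
... | no _                        = refl
... | yes (_ , _ , nonnegative , _) with nonnegative (Fin.suc Fin.zero)
...   | ()

sum-allWalks-suc : ∀ n (f : Vec Step (suc n) → ℤ) →
  sumℤ (map f (allWalks (suc n))) ≡
  sumℤ (map (λ w → f (up ∷ w)) (allWalks n)) ℤ.+
  (sumℤ (map (λ w → f (flat ∷ w)) (allWalks n)) ℤ.+ sumℤ (map (λ w → f (down ∷ w)) (allWalks n)))
sum-allWalks-suc n f = go (allWalks n)
  where
  after : Step → List (Vec Step n) → ℤ
  after s ws = sumℤ (map (λ w → f (s ∷ w)) ws)
  regroup : ∀ a b c x y z → a ℤ.+ (b ℤ.+ (c ℤ.+ (x ℤ.+ (y ℤ.+ z)))) ≡ (a ℤ.+ x) ℤ.+ ((b ℤ.+ y) ℤ.+ (c ℤ.+ z))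
  regroup = solve-∀
  go : ∀ ws → sumℤ (map f (concatMap (λ w → (up ∷ w) ∷ (flat ∷ w) ∷ (down ∷ w) ∷ []) ws)) ≡
              after up ws ℤ.+ (after flat ws ℤ.+ after down ws)
  go []       = refl
  go (w ∷ ws) = trans (cong (λ r → f (up ∷ w) ℤ.+ (f (flat ∷ w) ℤ.+ (f (down ∷ w) ℤ.+ r))) (go ws))
    (regroup (f (up ∷ w)) (f (flat ∷ w)) (f (down ∷ w)) (after up ws) (after flat ws) (after down ws))

suc# : ℕ → FPS
suc# zero    = 1#
suc# (suc g) = suc# g ⊕ 1#

suc#-* : ∀ g f → suc# g * f ≈ + suc g • f
suc#-* g f = ≈-trans (*-congˡ f (suc#≈constant g)) (constant-* (+ suc g) f)
  where
  suc#≈constant : ∀ g → suc# g ≈ constant (+ suc g)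
  suc#≈constant zero    zero    = refl
  suc#≈constant zero    (suc n) = refl
  suc#≈constant (suc g) zero    = trans (cong (ℤ._+ + 1) (suc#≈constant g 0)) (cong +_ (ℕP.+-comm (suc g) 1))
  suc#≈constant (suc g) (suc n) = trans (ℤP.+-identityʳ _) (suc#≈constant g (suc n))

passages : ℕ → FPS
passages g n = sumℤ (map (passage g) (allWalks n))

passageAreas : ℕ → FPS
passageAreas g n = sumℤ (map (passageArea g) (allWalks n))

passages-descend : ∀ g n → sumℤ (map (λ w → passage g (down ∷ w)) (allWalks n)) ≡ below 1# passages g n
passages-descend zero    zero    = refl
passages-descend zero    (suc n) = sum-map-zero (λ { (_ ∷ _) → refl }) (allWalks (suc n))
passages-descend (suc g) n       = refl

passages-solves : Solves (λ _ → 0#) 1# passages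
passages-solves = solves λ g → ≈⊕t*-intro 0# (neighbours 1# passages g) refl λ n →
  trans (sum-allWalks-suc n (passage g))
        (trans (cong (λ d → passages (suc g) n ℤ.+ (passages g n ℤ.+ d)) (passages-descend g n))
               (sym (ℤP.+-identityˡ _)))

passageAreas-descend : ∀ g n →
  sumℤ (map (λ w → areaAfterStep g (down ∷ w)) (allWalks n)) ≡ below 0# passageAreas g n
passageAreas-descend zero    n = sum-map-zero (λ _ → refl) (allWalks n)
passageAreas-descend (suc g) n = refl

passageAreas-recurrence : ∀ g n →
  passageAreas g (suc n) ≡ (suc# g * passages g) (suc n) ℤ.+ neighbours 0# passageAreas g n
passageAreas-recurrence g n = begin
  passageAreas g (suc n)
    ≡⟨ sum-map-cong (passageArea-∷ g) (allWalks (suc n)) ⟩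
  sumℤ (map (λ v → + suc g ℤ.* passage g v ℤ.+ areaAfterStep g v) (allWalks (suc n)))
    ≡⟨ sum-map-+ (λ v → + suc g ℤ.* passage g v) (areaAfterStep g) (allWalks (suc n)) ⟩
  sumℤ (map (λ v → + suc g ℤ.* passage g v) (allWalks (suc n))) ℤ.+
  sumℤ (map (areaAfterStep g) (allWalks (suc n)))
    ≡⟨ cong₂ ℤ._+_ (trans (sum-map-*ˡ (+ suc g) (passage g) (allWalks (suc n)))
                          (sym (suc#-* g (passages g) (suc n))))
                   (sum-allWalks-suc n (areaAfterStep g)) ⟩
  (suc# g * passages g) (suc n) ℤ.+
  (passageAreas (suc g) n ℤ.+ (passageAreas g n ℤ.+ sumℤ (map (λ w → areaAfterStep g (down ∷ w)) (allWalks n))))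
    ≡⟨ cong (λ d → (suc# g * passages g) (suc n) ℤ.+ (passageAreas (suc g) n ℤ.+ (passageAreas g n ℤ.+ d)))
            (passageAreas-descend g n) ⟩
  (suc# g * passages g) (suc n) ℤ.+ neighbours 0# passageAreas g n
    ∎
  where open ≡-Reasoning

passageAreas-solves : Solves (λ g → suc# g * passages g) 0# passageAreas
passageAreas-solves = solves λ g → ≈⊕t*-intro (suc# g * passages g) (neighbours 0# passageAreas g)
  (sym (ℤP.*-zeroʳ (suc# g 0))) (passageAreas-recurrence g)

a-suc : ∀ n → a (suc n) ≡ passageAreas 0 n
a-suc n = begin
  a (suc n)                                    ≡⟨ sum-map-cong (a-summand≡strictArea (suc n)) (allWalks (suc n)) ⟩
  sumℤ (map strictArea (allWalks (suc n)))    ≡⟨ sum-allWalks-suc n strictArea ⟩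
  _                                            ≡⟨ cong₂ ℤ._+_ (sum-map-cong strictArea-up (allWalks n))
                                                  (cong₂ ℤ._+_ (sum-map-zero strictArea-flat (allWalks n))
                                                               (sum-map-zero strictArea-down (allWalks n))) ⟩
  passageAreas 0 n ℤ.+ + 0                     ≡⟨ ℤP.+-identityʳ _ ⟩
  passageAreas 0 n                             ∎
  where open ≡-Reasoning

a≈t*passageAreas : a ≈ t * passageAreas 0
a≈t*passageAreas zero    = refl
a≈t*passageAreas (suc n) = trans (a-suc n) (sym (t*-suc (passageAreas 0) n))

-- Solving the systems

infixr 8 _^_
_^_ : FPS → ℕ → FPS
f ^ zero  = 1#
f ^ suc k = f * f ^ k

z : FPS
z = passages 0

passages-suc : ∀ g → passages (suc g) ≈ z * passages g
passages-suc = Solves-unique (λ _ → ≈-sym (zeroʳ z)) (≈-sym (*-identityʳ z))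
  (Solves-suc passages-solves) (Solves-scale z passages-solves)

passages≈^ : ∀ g → passages g ≈ z ^ suc g
passages≈^ zero    = ≈-sym (*-identityʳ z)
passages≈^ (suc g) = ≈-trans (passages-suc g) (*-congʳ z (passages≈^ g))

φ : FPS → FPS
φ u = u * u ⊕ (u ⊕ 1#)

kernel : t * φ z ≈ z
kernel = ≈-sym (begin
  z                                     ≈⟨ recursion passages-solves 0 ⟩
  0# ⊕ t * (passages 1 ⊕ (z ⊕ 1#))      ≈⟨ +-identityˡ _ ⟩
  t * (passages 1 ⊕ (z ⊕ 1#))           ≈⟨ *-congʳ t (⊕-congˡ (z ⊕ 1#) (passages-suc 0)) ⟩
  t * φ z                               ∎)
  where open ≈-Reasoning

Q : FPS → FPS
Q u = 1# ⊕ - (u * u)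

areaFactor : FPS → ℕ → FPS
areaFactor u zero    = 1#
areaFactor u (suc g) = areaFactor u g ⊕ suc# g * Q u ⊕ 1#

1ᵖ : ∀ {k} → Polynomial k
1ᵖ = con (+ 1)

φᵖ Qᵖ : ∀ {k} → Polynomial k → Polynomial k
φᵖ u = u :* u :+ (u :+ 1ᵖ)
Qᵖ u = 1ᵖ :+ :- (u :* u)

areaFactorᵖ : ∀ {k} → Polynomial k → Polynomial k → Polynomial k → Polynomial k
areaFactorᵖ u b n = b :+ n :* Qᵖ u :+ 1ᵖ

-- For u = z this is Q z ^ 2 times the area series of passages from height g + 1, as suggested by
-- splitting such a passage at its first visits to heights g, …, 1 into g + 1 passages from height 1.
candidate : FPS → ℕ → FPS
candidate u g = u ^ suc g * φ u * areaFactor u g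

candidate-solves : ∀ {u} → t * φ u ≈ u →
  Solves (λ g → Q u * Q u * (suc# g * u ^ suc g)) (constant (+ 0)) (candidate u)
candidate-solves {u} u≈tφ = solves λ { zero → at-zero ; (suc g) → at-suc g }
  where
  open ≈-Reasoning
  at-zero : candidate u 0 ≈ Q u * Q u * (1# * u ^ 1) ⊕ t * neighbours (constant (+ 0)) (candidate u) 0
  at-zero = ≈-sym (begin
    Q u * Q u * (1# * u ^ 1) ⊕ t * (candidate u 1 ⊕ (candidate u 0 ⊕ constant (+ 0)))
      ≈⟨ solve 2 (λ u t → Qᵖ u :* Qᵖ u :* (1ᵖ :* (u :* 1ᵖ))
                          :+ t :* ((u :* (u :* 1ᵖ)) :* φᵖ u :* areaFactorᵖ u 1ᵖ 1ᵖ :+ ((u :* 1ᵖ) :* φᵖ u :* 1ᵖ :+ con (+ 0)))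
                        := Qᵖ u :* Qᵖ u :* u :+ (t :* φᵖ u) :* (u :* u :* areaFactorᵖ u 1ᵖ 1ᵖ :+ u))
                 (λ _ → refl) u t ⟩
    Q u * Q u * u ⊕ (t * φ u) * (u * u * areaFactor u 1 ⊕ u)
      ≈⟨ ⊕-congʳ (Q u * Q u * u) (*-congˡ (u * u * areaFactor u 1 ⊕ u) u≈tφ) ⟩
    Q u * Q u * u ⊕ u * (u * u * areaFactor u 1 ⊕ u)
      ≈⟨ solve 1 (λ u → Qᵖ u :* Qᵖ u :* u :+ u :* (u :* u :* areaFactorᵖ u 1ᵖ 1ᵖ :+ u) := (u :* 1ᵖ) :* φᵖ u :* 1ᵖ)
                 (λ _ → refl) u ⟩
    candidate u 0
      ∎)
  at-suc : ∀ g → candidate u (suc g) ≈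
           Q u * Q u * (suc# (suc g) * u ^ suc (suc g)) ⊕ t * neighbours (constant (+ 0)) (candidate u) (suc g)
  at-suc g = ≈-sym (begin
    Q u * Q u * ((n ⊕ 1#) * (u * c)) ⊕ t * (candidate u (suc (suc g)) ⊕ (candidate u (suc g) ⊕ candidate u g))
      ≈⟨ solve 5 (λ u t c b n → Qᵖ u :* Qᵖ u :* ((n :+ 1ᵖ) :* (u :* c))
                   :+ t :* ((u :* (u :* c)) :* φᵖ u :* areaFactorᵖ u (areaFactorᵖ u b n) (n :+ 1ᵖ)
                            :+ ((u :* c) :* φᵖ u :* areaFactorᵖ u b n :+ c :* φᵖ u :* b))
                 := Qᵖ u :* Qᵖ u :* ((n :+ 1ᵖ) :* (u :* c))
                   :+ (t :* φᵖ u) :* (u :* u :* c :* areaFactorᵖ u (areaFactorᵖ u b n) (n :+ 1ᵖ) :+ (u :* c :* areaFactorᵖ u b n :+ c :* b)))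
                 (λ _ → refl) u t c b n ⟩
    Q u * Q u * ((n ⊕ 1#) * (u * c)) ⊕ (t * φ u) * rest
      ≈⟨ ⊕-congʳ (Q u * Q u * ((n ⊕ 1#) * (u * c))) (*-congˡ rest u≈tφ) ⟩
    Q u * Q u * ((n ⊕ 1#) * (u * c)) ⊕ u * rest
      ≈⟨ solve 4 (λ u c b n → Qᵖ u :* Qᵖ u :* ((n :+ 1ᵖ) :* (u :* c))
                   :+ u :* (u :* u :* c :* areaFactorᵖ u (areaFactorᵖ u b n) (n :+ 1ᵖ) :+ (u :* c :* areaFactorᵖ u b n :+ c :* b))
                 := (u :* c) :* φᵖ u :* areaFactorᵖ u b n)
                 (λ _ → refl) u c b n ⟩
    candidate u (suc g)
      ∎)
    where
    c b n rest : FPS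
    c = u ^ suc g
    b = areaFactor u g
    n = suc# g
    rest = u * u * c * areaFactor u (suc (suc g)) ⊕ (u * c * areaFactor u (suc g) ⊕ c * b)

passageAreas-closedForm : Q z * Q z * passageAreas 0 ≈ candidate z 0
passageAreas-closedForm =
  Solves-unique sources boundary (Solves-scale (Q z * Q z) passageAreas-solves) (candidate-solves kernel) 0
  where
  sources : ∀ g → Q z * Q z * (suc# g * passages g) ≈ Q z * Q z * (suc# g * z ^ suc g)
  sources g = *-congʳ (Q z * Q z) (*-congʳ (suc# g) (passages≈^ g))
  boundary : Q z * Q z * 0# ≈ constant (+ 0)
  boundary = ≈-trans (zeroʳ (Q z * Q z)) λ { zero → refl ; (suc n) → refl }

P-Horner : P ≈ constant -[1+ 0 ] ⊕ t * (constant (+ 2) ⊕ t * constant (+ 3))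
P-Horner zero    = refl
P-Horner (suc n) = sym (trans (⊕t*-suc (constant -[1+ 0 ]) _ n) (trans (ℤP.+-identityˡ _) (linear n)))
  where
  linear : ∀ n → (constant (+ 2) ⊕ t * constant (+ 3)) n ≡ P (suc n)
  linear zero          = refl
  linear (suc zero)    = ⊕t*-suc (constant (+ 2)) (constant (+ 3)) 0
  linear (suc (suc n)) = ⊕t*-suc (constant (+ 2)) (constant (+ 3)) (suc n)

t²≈t*t : t² ≈ t * t
t²≈t*t zero    = refl
t²≈t*t (suc n) = trans (shift n) (sym (t*-suc t n))
  where
  shift : ∀ n → t² (suc n) ≡ t n
  shift zero          = refl
  shift (suc zero)    = refl
  shift (suc (suc n)) = refl

annihilated-by-Q² : Q z * Q z * (P * X ⊕ t²) ≈ 0#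
annihilated-by-Q² = begin
  E * (P * X ⊕ t²)
    ≈⟨ *-congʳ E (λ n → cong₂ ℤ._+_ (≈-trans (*-congˡ X P-Horner) (*-congʳ Pₕ a≈t*passageAreas) n) (t²≈t*t n)) ⟩
  E * (Pₕ * (t * A) ⊕ t * t)
    ≈⟨ solve 4 (λ e p t x → e :* (p :* (t :* x) :+ t :* t) := p :* t :* (e :* x) :+ t :* t :* e)
               (λ _ → refl) E Pₕ t A ⟩
  Pₕ * t * (E * A) ⊕ t * t * E
    ≈⟨ ⊕-congˡ (t * t * E) (*-congʳ (Pₕ * t) passageAreas-closedForm) ⟩
  Pₕ * t * candidate z 0 ⊕ t * t * E
    ≈⟨ solve 5 (λ p t z f q → p :* t :* ((z :* 1ᵖ) :* f :* 1ᵖ) :+ q := p :* z :* (t :* f) :+ q)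
               (λ _ → refl) Pₕ t z (φ z) (t * t * E) ⟩
  Pₕ * z * (t * φ z) ⊕ t * t * E
    ≈⟨ ⊕-congˡ (t * t * E) (*-congʳ (Pₕ * z) kernel) ⟩
  Pₕ * z * z ⊕ t * t * E
    ≈⟨ solve 2 (λ t z → (con -[1+ 0 ] :+ t :* (con (+ 2) :+ t :* con (+ 3))) :* z :* z :+ t :* t :* (Qᵖ z :* Qᵖ z)
                      := (t :* φᵖ z :+ :- z) :* (t :+ z :+ :- (t :* z) :+ t :* z :* z))
               (λ _ → refl) t z ⟩
  (t * φ z ⊕ - z) * Γ
    ≈⟨ *-congˡ Γ (⊕-congˡ (- z) kernel) ⟩
  (z ⊕ - z) * Γ
    ≈⟨ *-congˡ Γ (λ n → ℤP.+-inverseʳ (z n)) ⟩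
  0# * Γ
    ≈⟨ *-zeroˡ Γ ⟩
  0#
    ∎
  where
  open ≈-Reasoning
  E A Pₕ Γ : FPS
  E  = Q z * Q z
  A  = passageAreas 0
  Pₕ = constant -[1+ 0 ] ⊕ t * (constant (+ 2) ⊕ t * constant (+ 3))
  Γ  = t ⊕ z ⊕ - (t * z) ⊕ t * z * z

mainTheorem1 : (n : ℕ) → ((P · X) ⊕ t²) n ≡ 𝟘 n
mainTheorem1 n = trans (cong (ℤ._+ t² n) (·≈* P X n)) (*≈0⇒≈0 refl annihilated-by-Q² n)
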